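{- There are TRSs that are incrementally polynomially terminating over $\mathbb{Q}$ but not incrementally polynomially terminating over $\mathbb{N}$.
   Context: For $D = \mathbb{Q}$: $D_0 = \{x\in\mathbb{Q}: x\ge0\}$; a polynomial interpretation over $\mathbb{Q}$ consists of rational $\delta>0$ and for each $n$-ary symbol $f$ a polynomial $f_\mathbb{Q} \in \mathbb{Q}[x_1,\dots,x_n]$ with $f_\mathbb{Q}(D_0^n)\subseteq D_0$; its strict order is $x>y$ iff $x-y\ge\delta$ (on $D_0$), its weak order is $\ge$ on $D_0$. For $D=\mathbb{N}$: a polynomial interpretation assigns $f_\mathbb{N}\in\mathbb{Z}[x_1,\dots,x_n]$ with $f_\mathbb{N}(\mathbb{N}^n)\subseteq\mathbb{N}$ and $f_\mathbb{N}$ strictly monotone w.r.t. the standard $>$ on $\mathbb{N}$; strict order $>$, weak order $\ge$ on $\mathbb{N}$. Terms are evaluated under assignments into the carrier. An interpretation is strictly (weakly) monotone if every interpretation function is monotone in each argument w.r.t. the strict (weak) order, and (weakly) compatible with a TRS if $[\alpha](\ell)>[\alpha](r)$ ($\ge$) for all rules $\ell\to r$ and all assignments $\alpha$. A TRS $\mathcal{R}$ is polynomially terminating over $D$ if some strictly monotone polynomial interpretation over $D$ is compatible with it. For $n\ge1$, $\mathcal{R}$ is polynomially terminating over $D$ in $n$ steps if either $n=1$ and $\mathcal{R}$ is polynomially terminating over $D$, or $n>1$ and there are a polynomial interpretation $\mathcal{P}$ over $D$ and nonempty $\mathcal{S}\subsetneq\mathcal{R}$ such that $\mathcal{P}$ is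 weakly and strictly monotone, weakly compatible with all of $\mathcal{R}$, compatible with all rules of $\mathcal{S}$, and $\mathcal{R}\setminus\mathcal{S}$ is polynomially terminating over $D$ in $n-1$ steps. $\mathcal{R}$ is incrementally polynomially terminating over $D$ if this holds for some $n\ge1$. -}

module Defs where

open import Data.Nat as ℕ using (ℕ; zero; suc)
open import Data.Fin using (Fin; _≟_)
open import Data.Fin.Subset using (Subset; _∈_; _⊂_; Nonempty; _─_; ⊤)
open import Data.Integer as ℤ using (ℤ; +_)
open import Data.Rational as ℚ using (ℚ; 0ℚ)
open import Data.Product using (Σ; ∃; _×_; _,_)
open import Relation.Nullary using (¬_; yes; no)
open import Relation.Binary.PropositionalEquality using (_≡_)

record Signature : Set where
  field
    nSym  : ℕ
    arity : Fin nSym → ℕ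
open Signature public

data Term (Σ' : Signature) : Set where
  var : ℕ → Term Σ'
  fun : (f : Fin (nSym Σ')) → (Fin (arity Σ' f) → Term Σ') → Term Σ'

Occurs : {Σ' : Signature} → ℕ → Term Σ' → Set
Occurs x (var y)    = x ≡ y
Occurs x (fun f ts) = ∃ λ i → Occurs x (ts i)

IsVar : {Σ' : Signature} → Term Σ' → Set
IsVar (var _)   = Data.Unit.⊤
  where import Data.Unit
IsVar (fun _ _) = Data.Empty.⊥
  where import Data.Empty

record Rule (Σ' : Signature) : Set where
  constructor _⟶_
  field
    lhs rhs : Term Σ'
open Rule public

WellFormed : {Σ' : Signature} → Rule Σ' → Set
WellFormed (l ⟶ r) = ¬ IsVar l × (∀ x → Occurs x r → Occurs x l)

-- A (finite) TRS: a signature and finitely many well-formed rules,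
-- indexed by Fin nRules.  Sub-TRSs are subsets of these indices.
record TRS : Set where
  field
    sig       : Signature
    nRules    : ℕ
    rules     : Fin nRules → Rule sig
    wellFormed : ∀ i → WellFormed (rules i)
open TRS public

-- Polynomials with coefficients in A in variables x_0..x_{n-1}
-- (syntactic polynomial expressions; they denote exactly A[x_1..x_n]).

data Poly (A : Set) (n : ℕ) : Set where
  con  : A → Poly A n
  x    : Fin n → Poly A n
  _⊕_  : Poly A n → Poly A n → Poly A n
  _⊗_  : Poly A n → Poly A n → Poly A n

module _ {A : Set} (_+'_ _*'_ : A → A → A) where
  evalP : ∀ {n} → Poly A n → (Fin n → A) → A
  evalP (con c) ρ = c
  evalP (x i)   ρ = ρ i
  evalP (p ⊕ q) ρ = evalP p ρ +' evalP q ρ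
  evalP (p ⊗ q) ρ = evalP p ρ *' evalP q ρ

evalℚ : ∀ {n} → Poly ℚ n → (Fin n → ℚ) → ℚ
evalℚ = evalP ℚ._+_ ℚ._*_

evalℤ : ∀ {n} → Poly ℤ n → (Fin n → ℤ) → ℤ
evalℤ = evalP ℤ._+_ ℤ._*_

upd : ∀ {A : Set} {n} → (Fin n → A) → Fin n → A → Fin n → A
upd ρ i a j with j ≟ i
... | yes _ = a
... | no  _ = ρ j

⟦_⟧ : {Σ' : Signature} {C : Set} → Term Σ' →
      ((f : Fin (nSym Σ')) → (Fin (arity Σ' f) → C) → C) → (ℕ → C) → C
⟦ var y ⟧    I α = α y
⟦ fun f ts ⟧ I α = I f (λ i → ⟦ ts i ⟧ I α)

Nonneg : ℚ → Set
Nonneg q = 0ℚ ℚ.≤ q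

record PolyInterpℚ (Σ' : Signature) : Set where
  field
    δ       : ℚ
    δ-pos   : 0ℚ ℚ.< δ
    poly    : (f : Fin (nSym Σ')) → Poly ℚ (arity Σ' f)
    closed  : ∀ f (ρ : Fin (arity Σ' f) → ℚ) → (∀ i → Nonneg (ρ i)) →
              Nonneg (evalℚ (poly f) ρ)
open PolyInterpℚ public

module _ {Σ' : Signature} (P : PolyInterpℚ Σ') where
  _>δ_ : ℚ → ℚ → Set
  a >δ b = δ P ℚ.≤ a ℚ.- b

  interpℚ : (f : Fin (nSym Σ')) → (Fin (arity Σ' f) → ℚ) → ℚ
  interpℚ f = evalℚ (poly P f)

  StrictlyMonotoneℚ : Set
  StrictlyMonotoneℚ = ∀ f (ρ : Fin (arity Σ' f) → ℚ) i (a b : ℚ) →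
    (∀ j → Nonneg (ρ j)) → Nonneg a → Nonneg b → a >δ b →
    interpℚ f (upd ρ i a) >δ interpℚ f (upd ρ i b)

  WeaklyMonotoneℚ : Set
  WeaklyMonotoneℚ = ∀ f (ρ : Fin (arity Σ' f) → ℚ) i (a b : ℚ) →
    (∀ j → Nonneg (ρ j)) → Nonneg a → Nonneg b → b ℚ.≤ a →
    interpℚ f (upd ρ i b) ℚ.≤ interpℚ f (upd ρ i a)

  Compatibleℚ : Rule Σ' → Set
  Compatibleℚ (l ⟶ r) = ∀ (α : ℕ → ℚ) → (∀ y → Nonneg (α y)) →
    ⟦ l ⟧ interpℚ α >δ ⟦ r ⟧ interpℚ α

  WeaklyCompatibleℚ : Rule Σ' → Set
  WeaklyCompatibleℚ (l ⟶ r) = ∀ (α : ℕ → ℚ) → (∀ y → Nonneg (α y)) →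
    ⟦ r ⟧ interpℚ α ℚ.≤ ⟦ l ⟧ interpℚ α

-- Polynomial interpretations over ℕ (integer polynomials mapping ℕ^n to ℕ,
-- strictly monotone w.r.t. > on ℕ). Values are computed in ℤ.

record PolyInterpℕ (Σ' : Signature) : Set where
  field
    polyℕ   : (f : Fin (nSym Σ')) → Poly ℤ (arity Σ' f)
    closedℕ : ∀ f (ρ : Fin (arity Σ' f) → ℕ) →
              ℤ.0ℤ ℤ.≤ evalℤ (polyℕ f) (λ i → + ρ i)
    strictℕ : ∀ f (ρ : Fin (arity Σ' f) → ℕ) i (a b : ℕ) → b ℕ.< a →
              evalℤ (polyℕ f) (λ j → + upd ρ i b j)
                ℤ.< evalℤ (polyℕ f) (λ j → + upd ρ i a j)
open PolyInterpℕ public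

module _ {Σ' : Signature} (P : PolyInterpℕ Σ') where
  interpℕ : (f : Fin (nSym Σ')) → (Fin (arity Σ' f) → ℤ) → ℤ
  interpℕ f = evalℤ (polyℕ P f)

  WeaklyMonotoneℕ : Set
  WeaklyMonotoneℕ = ∀ f (ρ : Fin (arity Σ' f) → ℕ) i (a b : ℕ) → b ℕ.≤ a →
    interpℕ f (λ j → + upd ρ i b j) ℤ.≤ interpℕ f (λ j → + upd ρ i a j)

  Compatibleℕ : Rule Σ' → Set
  Compatibleℕ (l ⟶ r) = ∀ (α : ℕ → ℕ) →
    ⟦ r ⟧ interpℕ (λ y → + α y) ℤ.< ⟦ l ⟧ interpℕ (λ y → + α y)

  WeaklyCompatibleℕ : Rule Σ' → Set
  WeaklyCompatibleℕ (l ⟶ r) = ∀ (α : ℕ → ℕ) →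
    ⟦ r ⟧ interpℕ (λ y → + α y) ℤ.≤ ⟦ l ⟧ interpℕ (λ y → + α y)

module _ (R : TRS) where
  private
    S' = sig R
    m  = nRules R

  PolyTermℚ : Subset m → Set
  PolyTermℚ A = Σ (PolyInterpℚ S') λ P → StrictlyMonotoneℚ P ×
    (∀ i → i ∈ A → Compatibleℚ P (rules R i))

  PolyTermℕ : Subset m → Set
  PolyTermℕ A = Σ (PolyInterpℕ S') λ P →
    (∀ i → i ∈ A → Compatibleℕ P (rules R i))

  -- PolyTermℚInSteps n A : the sub-TRS A is polynomially terminating
  -- over ℚ in (n + 1) steps.
  PolyTermℚInSteps : ℕ → Subset m → Set
  PolyTermℚInSteps zero    A = PolyTermℚ A
  PolyTermℚInSteps (suc n) A = Σ (PolyInterpℚ S') λ P → Σ (Subset m) λ S →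
    Nonempty S × S ⊂ A ×
    WeaklyMonotoneℚ P × StrictlyMonotoneℚ P ×
    (∀ i → i ∈ A → WeaklyCompatibleℚ P (rules R i)) ×
    (∀ i → i ∈ S → Compatibleℚ P (rules R i)) ×
    PolyTermℚInSteps n (A ─ S)

  PolyTermℕInSteps : ℕ → Subset m → Set
  PolyTermℕInSteps zero    A = PolyTermℕ A
  PolyTermℕInSteps (suc n) A = Σ (PolyInterpℕ S') λ P → Σ (Subset m) λ S →
    Nonempty S × S ⊂ A ×
    WeaklyMonotoneℕ P ×
    (∀ i → i ∈ A → WeaklyCompatibleℕ P (rules R i)) ×
    (∀ i → i ∈ S → Compatibleℕ P (rules R i)) ×
    PolyTermℕInSteps n (A ─ S)

  IncPolyTermℚ : Set
  IncPolyTermℚ = ∃ λ n → PolyTermℚInSteps n ⊤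

  IncPolyTermℕ : Set
  IncPolyTermℕ = ∃ λ n → PolyTermℕInSteps n ⊤

-- The witness is R = { f(a) → f(b) , g(b) → g(a) } with f, g unary and a, b
-- constants.
--
-- Over ℚ one strict step suffices: with δ = 1 take
--   f(y) = 6y² − 5y + 5,   g(y) = 2y,   a = 0,   b = ½.
-- Then f(a) − f(b) = 5 − 4 = 1 and g(b) − g(a) = 1, and f, g are
-- δ-monotone on ℚ≥0 although f is not monotone in the usual sense: it is
-- decreasing on [0, 5/12], which is exactly what the rule f(a) → f(b) needs.
--
-- Over ℕ no incremental proof exists.  Any such proof starts with an
-- interpretation orienting every rule weakly and some rule strictly
-- (firstStepℕ).  Over ℕ the values of a and b are natural numbers and the
-- unary interpretations are strictly increasing maps ℕ → ℤ, hence reflect ≤.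
-- The weak orientation of the two rules gives b ≤ a and a ≤ b, so a = b and
-- neither rule can be strictly decreasing (noOrientationℕ).

module Submission where

open import Defs
open import Data.Product using (∃; _×_; _,_)
open import Relation.Nullary using (¬_)

open import Data.Nat as ℕ using (ℕ; zero; suc)
import Data.Nat.Properties as ℕP
open import Data.Fin using (Fin; zero; suc)
open import Data.Fin.Subset.Properties using (∈⊤)
open import Data.Integer as ℤ using (ℤ; +_; -[1+_])
import Data.Integer.Properties as ℤP
open import Data.Rational as ℚ using (ℚ; 0ℚ; 1ℚ; ½; _/_; _≤_; _+_; _*_; _-_)
open import Data.Rational.Properties as ℚP using (nonNegative⁻¹)
open import Data.Rational.Solver using (module +-*-Solver)
open import Data.Sum using (inj₁; inj₂)
open import Function using (_∘_)
open import Relation.Nullary.Decidable using (toWitness; True)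
open import Relation.Binary.PropositionalEquality
  using (_≡_; refl; sym; cong; cong₂; subst; subst₂; module ≡-Reasoning)

open +-*-Solver using (solve; _:=_; _:+_; _:*_; _:-_; con)

2ℚ 5ℚ 6ℚ 7ℚ 12ℚ -5ℚ : ℚ
2ℚ  = + 2 / 1
5ℚ  = + 5 / 1
6ℚ  = + 6 / 1
7ℚ  = + 7 / 1
12ℚ = + 12 / 1
-5ℚ = -[1+ 4 ] / 1

0≤+ : ∀ {p q} → 0ℚ ≤ p → 0ℚ ≤ q → 0ℚ ≤ p + q
0≤+ {p} {q} 0≤p 0≤q = subst (_≤ p + q) (ℚP.+-identityˡ 0ℚ) (ℚP.+-mono-≤ 0≤p 0≤q)

0≤* : ∀ {p q} → 0ℚ ≤ p → 0ℚ ≤ q → 0ℚ ≤ p * q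
0≤* {p} {q} 0≤p 0≤q = nonNegative⁻¹ (p * q)
  {{ℚP.nonNeg*nonNeg⇒nonNeg p {{ℚ.nonNegative 0≤p}} q {{ℚ.nonNegative 0≤q}}}}

0≤-lit : ∀ c → {True (0ℚ ℚ.≤? c)} → 0ℚ ≤ c
0≤-lit c {c≥0} = toWitness c≥0

p≤q⇒0≤q-p : ∀ {p q} → p ≤ q → 0ℚ ≤ q - p
p≤q⇒0≤q-p {p} {q} p≤q = subst (_≤ q - p) (ℚP.+-inverseʳ p) (ℚP.+-monoˡ-≤ (ℚ.- p) p≤q)

≤-byDifference : ∀ {p q} r → q - p ≡ r → 0ℚ ≤ r → p ≤ q
≤-byDifference {p} {q} r q-p≡r 0≤r =
  subst₂ _≤_ (ℚP.+-identityʳ p) p+[q-p]≡q (ℚP.+-monoʳ-≤ p (subst (0ℚ ≤_) (sym q-p≡r) 0≤r))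
  where
  p+[q-p]≡q : p + (q - p) ≡ q
  p+[q-p]≡q = solve 2 (λ p q → p :+ (q :- p) := q) refl p q

evalP-cong : ∀ {A : Set} (_+'_ _*'_ : A → A → A) {n} (p : Poly A n) {ρ σ : Fin n → A} →
             (∀ i → ρ i ≡ σ i) → evalP _+'_ _*'_ p ρ ≡ evalP _+'_ _*'_ p σ
evalP-cong _+'_ _*'_ (con c) ρ≗σ = refl
evalP-cong _+'_ _*'_ (x i)   ρ≗σ = ρ≗σ i
evalP-cong _+'_ _*'_ (p ⊕ q) ρ≗σ =
  cong₂ _+'_ (evalP-cong _+'_ _*'_ p ρ≗σ) (evalP-cong _+'_ _*'_ q ρ≗σ)
evalP-cong _+'_ _*'_ (p ⊗ q) ρ≗σ =
  cong₂ _*'_ (evalP-cong _+'_ _*'_ p ρ≗σ) (evalP-cong _+'_ _*'_ q ρ≗σ)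

StrictlyMonotoneOnℕ : ∀ {n} → Poly ℤ n → Set
StrictlyMonotoneOnℕ {n} p = ∀ (ρ : Fin n → ℕ) i (m k : ℕ) → k ℕ.< m →
  evalℤ p (λ j → + upd ρ i k j) ℤ.< evalℤ p (λ j → + upd ρ i m j)

unary-increasing : (p : Poly ℤ 1) → StrictlyMonotoneOnℕ p →
                   ∀ {m n} → m ℕ.< n → evalℤ p (λ _ → + m) ℤ.< evalℤ p (λ _ → + n)
unary-increasing p mono {m} {n} m<n =
  subst₂ ℤ._<_ (evalP-cong ℤ._+_ ℤ._*_ p λ { zero → refl })
               (evalP-cong ℤ._+_ ℤ._*_ p λ { zero → refl })
               (mono (λ _ → 0) zero n m m<n)

unary-reflects-≤ : (p : Poly ℤ 1) → StrictlyMonotoneOnℕ p →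
                   ∀ {m n} → evalℤ p (λ _ → + m) ℤ.≤ evalℤ p (λ _ → + n) → m ℕ.≤ n
unary-reflects-≤ p mono pm≤pn = ℕP.≮⇒≥ (λ n<m → ℤP.<⇒≱ (unary-increasing p mono n<m) pm≤pn)

nullary-natural : (p : Poly ℤ 0) → (∀ (ρ : Fin 0 → ℕ) → ℤ.0ℤ ℤ.≤ evalℤ p (λ i → + ρ i)) →
                  ∀ (σ : Fin 0 → ℤ) → + ℤ.∣ evalℤ p σ ∣ ≡ evalℤ p σ
nullary-natural p nonneg σ =
  ℤP.0≤i⇒+∣i∣≡i (subst (ℤ.0ℤ ℤ.≤_) (evalP-cong ℤ._+_ ℤ._*_ p {σ = σ} λ ()) (nonneg λ ()))

compatible⇒weaklyCompatible : ∀ {Σ'} (P : PolyInterpℕ Σ') (ρ : Rule Σ') →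
                              Compatibleℕ P ρ → WeaklyCompatibleℕ P ρ
compatible⇒weaklyCompatible P (l ⟶ r) r<l α = ℤP.<⇒≤ (r<l α)

firstStepℕ : (T : TRS) → Fin (nRules T) → IncPolyTermℕ T →
             ∃ λ P → (∀ i → WeaklyCompatibleℕ P (rules T i)) ×
                     ∃ λ i → Compatibleℕ P (rules T i)
firstStepℕ T i₀ (zero , P , compat) =
  P , (λ i → compatible⇒weaklyCompatible P (rules T i) (compat i ∈⊤)) , i₀ , compat i₀ ∈⊤
firstStepℕ T _ (suc _ , P , _ , (i , i∈S) , _ , _ , weak , strict , _) =
  P , (λ i → weak i ∈⊤) , i , strict i i∈S

-- f is a parabola: it decreases on [0, 5/12] but still rises by at least 1
-- whenever its argument rises by at least 1.
fℚ : ℚ → ℚ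
fℚ y = (6ℚ * (y * y) + -5ℚ * y) + 5ℚ

gℚ : ℚ → ℚ
gℚ y = 2ℚ * y

-- f maps ℚ≥0 into ℚ≥0: for y ≤ 1, f y = 6y² + 5(1 − y); for y ≥ 1,
-- f y = 6y(y − 1) + y + 5.
fℚ-nonneg : ∀ y → 0ℚ ≤ y → 0ℚ ≤ fℚ y
fℚ-nonneg y 0≤y with ℚP.≤-total y 1ℚ
... | inj₁ y≤1 = subst (0ℚ ≤_) (sym small)
        (0≤+ (0≤* (0≤-lit 6ℚ) (0≤* 0≤y 0≤y)) (0≤* (0≤-lit 5ℚ) (p≤q⇒0≤q-p y≤1)))
  where
  small : fℚ y ≡ 6ℚ * (y * y) + 5ℚ * (1ℚ - y)
  small = solve 1 (λ y → (con 6ℚ :* (y :* y) :+ con -5ℚ :* y) :+ con 5ℚ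
                         := con 6ℚ :* (y :* y) :+ con 5ℚ :* (con 1ℚ :- y)) refl y
... | inj₂ 1≤y = subst (0ℚ ≤_) (sym large)
        (0≤+ (0≤+ (0≤* (0≤-lit 6ℚ) (0≤* 0≤y (p≤q⇒0≤q-p 1≤y))) 0≤y) (0≤-lit 5ℚ))
  where
  large : fℚ y ≡ (6ℚ * (y * (y - 1ℚ)) + y) + 5ℚ
  large = solve 1 (λ y → (con 6ℚ :* (y :* y) :+ con -5ℚ :* y) :+ con 5ℚ
                         := (con 6ℚ :* (y :* (y :- con 1ℚ)) :+ y) :+ con 5ℚ) refl y

-- δ-monotonicity of f on ℚ≥0.  Writing w = u − v − 1 ≥ 0,
-- f u − f v − 1 = 6w² + 12wv + 7w + 12v.
fℚ-δmono : ∀ u v → 0ℚ ≤ v → 1ℚ ≤ u - v → 1ℚ ≤ fℚ u - fℚ v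
fℚ-δmono u v 0≤v 1≤u-v = ≤-byDifference _ certificate
  (0≤+ (0≤+ (0≤+ (0≤* (0≤-lit 6ℚ) (0≤* 0≤w 0≤w)) (0≤* (0≤-lit 12ℚ) (0≤* 0≤w 0≤v)))
            (0≤* (0≤-lit 7ℚ) 0≤w))
       (0≤* (0≤-lit 12ℚ) 0≤v))
  where
  w = (u - v) - 1ℚ
  0≤w : 0ℚ ≤ w
  0≤w = p≤q⇒0≤q-p 1≤u-v
  certificate : (fℚ u - fℚ v) - 1ℚ ≡ ((6ℚ * (w * w) + 12ℚ * (w * v)) + 7ℚ * w) + 12ℚ * v
  certificate = solve 2 (λ u v →
    let w = (u :- v) :- con 1ℚ in
    (((con 6ℚ :* (u :* u) :+ con -5ℚ :* u) :+ con 5ℚ)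
      :- ((con 6ℚ :* (v :* v) :+ con -5ℚ :* v) :+ con 5ℚ)) :- con 1ℚ
    := ((con 6ℚ :* (w :* w) :+ con 12ℚ :* (w :* v)) :+ con 7ℚ :* w) :+ con 12ℚ :* v)
    refl u v

-- δ-monotonicity of g: g u − g v − 1 = 1 + 2(u − v − 1).
gℚ-δmono : ∀ u v → 1ℚ ≤ u - v → 1ℚ ≤ gℚ u - gℚ v
gℚ-δmono u v 1≤u-v = ≤-byDifference _ certificate
  (0≤+ (0≤-lit 1ℚ) (0≤* (0≤-lit 2ℚ) (p≤q⇒0≤q-p 1≤u-v)))
  where
  certificate : (gℚ u - gℚ v) - 1ℚ ≡ 1ℚ + 2ℚ * ((u - v) - 1ℚ)
  certificate = solve 2 (λ u v → (con 2ℚ :* u :- con 2ℚ :* v) :- con 1ℚ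
                                 := con 1ℚ :+ con 2ℚ :* ((u :- v) :- con 1ℚ)) refl u v

pattern fₛ = zero
pattern gₛ = suc zero
pattern aₛ = suc (suc zero)
pattern bₛ = suc (suc (suc zero))

arityFGAB : Fin 4 → ℕ
arityFGAB fₛ = 1
arityFGAB gₛ = 1
arityFGAB aₛ = 0
arityFGAB bₛ = 0

ΣFGAB : Signature
ΣFGAB = record { nSym = 4 ; arity = arityFGAB }

a b : Term ΣFGAB
a = fun aₛ (λ ())
b = fun bₛ (λ ())

infix 30 _⟨_⟩

_⟨_⟩ : Fin 4 → Term ΣFGAB → Term ΣFGAB
h ⟨ t ⟩ = fun h (λ _ → t)

pattern ruleF = zero
pattern ruleG = suc zero

rulesR : Fin 2 → Rule ΣFGAB
rulesR ruleF = fₛ ⟨ a ⟩ ⟶ fₛ ⟨ b ⟩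
rulesR ruleG = gₛ ⟨ b ⟩ ⟶ gₛ ⟨ a ⟩

-- Both rules are ground, so their right-hand sides have no variables.
rulesR-wellFormed : ∀ i → WellFormed (rulesR i)
rulesR-wellFormed ruleF = (λ ()) , λ { _ (_ , () , _) }
rulesR-wellFormed ruleG = (λ ()) , λ { _ (_ , () , _) }

R : TRS
R = record { sig = ΣFGAB ; nRules = 2 ; rules = rulesR ; wellFormed = rulesR-wellFormed }

polyℚ : (h : Fin 4) → Poly ℚ (arityFGAB h)
polyℚ fₛ = ((con 6ℚ ⊗ (x zero ⊗ x zero)) ⊕ (con -5ℚ ⊗ x zero)) ⊕ con 5ℚ
polyℚ gₛ = con 2ℚ ⊗ x zero
polyℚ aₛ = con 0ℚ
polyℚ bₛ = con ½

polyℚ-nonneg : ∀ h (ρ : Fin (arityFGAB h) → ℚ) → (∀ i → Nonneg (ρ i)) →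
               Nonneg (evalℚ (polyℚ h) ρ)
polyℚ-nonneg fₛ ρ ρ≥0 = fℚ-nonneg (ρ zero) (ρ≥0 zero)
polyℚ-nonneg gₛ ρ ρ≥0 = 0≤* (0≤-lit 2ℚ) (ρ≥0 zero)
polyℚ-nonneg aₛ _ _ = 0≤-lit 0ℚ
polyℚ-nonneg bₛ _ _ = 0≤-lit ½

interpretationℚ : PolyInterpℚ ΣFGAB
interpretationℚ = record
  { δ = 1ℚ ; δ-pos = toWitness {a? = 0ℚ ℚ.<? 1ℚ} _ ; poly = polyℚ ; closed = polyℚ-nonneg }

interpretationℚ-strictlyMonotone : StrictlyMonotoneℚ interpretationℚ
interpretationℚ-strictlyMonotone fₛ _ zero u v _ _ v≥0 u>v = fℚ-δmono u v v≥0 u>v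
interpretationℚ-strictlyMonotone gₛ _ zero u v _ _ _   u>v = gℚ-δmono u v u>v
interpretationℚ-strictlyMonotone aₛ _ () u v _ _ _ _
interpretationℚ-strictlyMonotone bₛ _ () u v _ _ _ _

interpretationℚ-compatible : ∀ i → Compatibleℚ interpretationℚ (rulesR i)
interpretationℚ-compatible ruleF _ _ = toWitness {a? = 1ℚ ℚ.≤? (fℚ 0ℚ - fℚ ½)} _
interpretationℚ-compatible ruleG _ _ = toWitness {a? = 1ℚ ℚ.≤? (gℚ ½ - gℚ 0ℚ)} _

module Overℕ (P : PolyInterpℕ ΣFGAB) where

  ⟦_⟧₀ : Term ΣFGAB → ℤ
  ⟦ t ⟧₀ = ⟦ t ⟧ (interpℕ P) (λ _ → + 0)

  ∣a∣ ∣b∣ : ℕ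
  ∣a∣ = ℤ.∣ ⟦ a ⟧₀ ∣
  ∣b∣ = ℤ.∣ ⟦ b ⟧₀ ∣

  a-natural : + ∣a∣ ≡ ⟦ a ⟧₀
  a-natural = nullary-natural (polyℕ P aₛ) (closedℕ P aₛ) _

  b-natural : + ∣b∣ ≡ ⟦ b ⟧₀
  b-natural = nullary-natural (polyℕ P bₛ) (closedℕ P bₛ) _

  -- ⟦ h⟨t⟩ ⟧₀ is unaryℤ h ⟦ t ⟧₀ by definition.
  unaryℤ : (h : Fin 4) → ℤ → ℤ
  unaryℤ h z = interpℕ P h (λ _ → z)

  -- Since f and g are strictly increasing on ℕ, weakly orienting f(a) → f(b)
  -- forces ∣b∣ ≤ ∣a∣ and weakly orienting g(b) → g(a) forces ∣a∣ ≤ ∣b∣.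
  constants-equal : ⟦ fₛ ⟨ b ⟩ ⟧₀ ℤ.≤ ⟦ fₛ ⟨ a ⟩ ⟧₀ → ⟦ gₛ ⟨ a ⟩ ⟧₀ ℤ.≤ ⟦ gₛ ⟨ b ⟩ ⟧₀ →
        ⟦ a ⟧₀ ≡ ⟦ b ⟧₀
  constants-equal fb≤fa ga≤gb = begin
    ⟦ a ⟧₀  ≡⟨ sym a-natural ⟩
    + ∣a∣   ≡⟨ cong +_ (ℕP.≤-antisym ∣a∣≤∣b∣ ∣b∣≤∣a∣) ⟩
    + ∣b∣   ≡⟨ b-natural ⟩
    ⟦ b ⟧₀  ∎
    where
    open ≡-Reasoning
    ∣b∣≤∣a∣ : ∣b∣ ℕ.≤ ∣a∣
    ∣b∣≤∣a∣ = unary-reflects-≤ (polyℕ P fₛ) (strictℕ P fₛ)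
      (subst₂ ℤ._≤_ (cong (unaryℤ fₛ) (sym b-natural)) (cong (unaryℤ fₛ) (sym a-natural)) fb≤fa)
    ∣a∣≤∣b∣ : ∣a∣ ℕ.≤ ∣b∣
    ∣a∣≤∣b∣ = unary-reflects-≤ (polyℕ P gₛ) (strictℕ P gₛ)
      (subst₂ ℤ._≤_ (cong (unaryℤ gₛ) (sym a-natural)) (cong (unaryℤ gₛ) (sym b-natural)) ga≤gb)

  rules-collapse : ⟦ a ⟧₀ ≡ ⟦ b ⟧₀ → ∀ i → ⟦ rhs (rulesR i) ⟧₀ ≡ ⟦ lhs (rulesR i) ⟧₀
  rules-collapse a=b ruleF = cong (unaryℤ fₛ) (sym a=b)
  rules-collapse a=b ruleG = cong (unaryℤ gₛ) a=b

noOrientationℕ : ¬ (∃ λ P → (∀ i → WeaklyCompatibleℕ P (rulesR i)) ×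
                            ∃ λ i → Compatibleℕ P (rulesR i))
noOrientationℕ (P , weak , i , strict) =
  ℤP.<-irrefl (rules-collapse a=b i) (strict (λ _ → 0))
  where
  open Overℕ P
  a=b : ⟦ a ⟧₀ ≡ ⟦ b ⟧₀
  a=b = constants-equal (weak ruleF (λ _ → 0)) (weak ruleG (λ _ → 0))

theorem6p5 : ∃ λ (R : TRS) → IncPolyTermℚ R × ¬ IncPolyTermℕ R
theorem6p5 = R , incrementalℚ , noOrientationℕ ∘ firstStepℕ R ruleF
  where
  incrementalℚ : IncPolyTermℚ R
  incrementalℚ = zero , interpretationℚ , interpretationℚ-strictlyMonotone ,
                 λ i _ → interpretationℚ-compatible i
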